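{- For every rational number $t$, the number $(t^2-2)(t^2-3)$ is not the square of a rational number. -}

module Defs where

{-# OPTIONS --safe #-}
-- Write t = A/B in lowest terms. Clearing denominators, (A² − 2B²)(A² − 3B²) must be the square of
-- an integer. Its factors differ by B², are coprime and have the same sign, so either A² − 2B² = u²
-- and A² − 3B² = v², or 2B² − A² and 3B² − A² = v² are squares; the latter gives A² + v² = 3B²,
-- impossible modulo 9. The former is a primitive solution of a² = 2b² + u², a² = 3b² + v² with b > 0,
-- and there is none, by descent: modulo 4, b is even and a, u, v are odd; halving (u − v)(u + v) = b²
-- and (a − u)(a + u) = 2b² gives b = 2mn, u = m² + n² and coprime factors p (u + p) = 2(mn)². One way
-- of splitting them is impossible modulo 3; the other yields, through the four-number lemma
-- rs = mn ⇒ m = βα, r = γα, n = δγ, s = βδ, a primitive solution whose b is α or γ, a divisor of mn.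
module Submission where

module Naturals where

  open import Data.Empty using (⊥; ⊥-elim)
  open import Data.Fin using (Fin; toℕ)
  open import Data.Fin.Properties using (all?; toℕ-fromℕ<)
  open import Data.Nat.Base
  open import Data.Nat.Coprimality as Coprime using (Coprime; coprime-divisor; coprime-/gcd)
  open import Data.Nat.Divisibility
  open import Data.Nat.DivMod
  open import Data.Nat.GCD using (gcd; gcd[m,n]∣m; gcd[m,n]∣n; gcd[m,n]≢0; c*gcd[m,n]≡gcd[cm,cn]; gcd-greatest)
  open import Data.Nat.Induction using (<-rec)
  open import Data.Nat.Primality using (Prime; prime?; prime[2]; prime⇒irreducible; euclidsLemma)
  open import Data.Nat.Properties
  open import Algebra.Properties.CommutativeSemigroup *-commutativeSemigroup using (interchange; xy∙z≈xz∙y; x∙yz≈z∙xy; x∙yz≈z∙yx)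
  open import Data.Nat.Tactic.RingSolver using (solve-∀)
  open import Data.Product as Product using (Σ-syntax; ∃-syntax; ∃₂; _×_; _,_)
  open import Data.Sum as Sum using (_⊎_; inj₁; inj₂)
  open import Relation.Binary.PropositionalEquality using (_≡_; _≢_; refl; sym; trans; cong; cong₂; subst; subst₂; module ≡-Reasoning)
  open import Relation.Nullary using (¬_; contradiction)
  open import Relation.Nullary.Decidable using (from-yes; _→-dec_; _⊎-dec_; _×-dec_)

  private variable
    b d e k m n o x y z : ℕ

  -- `with` normalises its scrutinee completely, so ring-solver certificates, finite decision
  -- procedures and gcd/Bézout witnesses are kept opaque: unfolded there, they blow up type checking.
  opaque
    r+[q+n]*2≡r+q*2+2n : ∀ r q n → r + (q + n) * 2 ≡ (r + q * 2) + 2 * n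
    r+[q+n]*2≡r+q*2+2n = solve-∀

    [y+2n]²≡4n[y+n]+y² : ∀ y n → (y + 2 * n) * (y + 2 * n) ≡ 4 * (n * (y + n)) + y * y
    [y+2n]²≡4n[y+n]+y² = solve-∀

    y+2n≡[y+n]+n : ∀ y n → y + 2 * n ≡ (y + n) + n
    y+2n≡[y+n]+n = solve-∀

    3x+y≡2x+[x+y] : ∀ x y → 3 * x + y ≡ 2 * x + (x + y)
    3x+y≡2x+[x+y] = solve-∀

    x+3y≡2y+[x+y] : ∀ x y → x + 3 * y ≡ 2 * y + (x + y)
    x+3y≡2y+[x+y] = solve-∀

    x+y+2x≡y+3x : ∀ x y → x + y + 2 * x ≡ y + 3 * x
    x+y+2x≡y+3x = solve-∀

    [c*2]²≡4c² : ∀ c → (c * 2) * (c * 2) ≡ 4 * (c * c)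
    [c*2]²≡4c² = solve-∀

    2[c*2]²≡4[2c²] : ∀ c → 2 * ((c * 2) * (c * 2)) ≡ 4 * (2 * (c * c))
    2[c*2]²≡4[2c²] = solve-∀

    four-number-expansion : ∀ α β γ δ → 2 * ((γ * α) * (γ * α)) + ((β * α) * (β * α) + (δ * γ) * (δ * γ))
                                        ≡ (β * β) * (α * α) + (γ * γ) * (δ * δ + 2 * (α * α))
    four-number-expansion = solve-∀

  m*m≤n*n⇒m≤n : m * m ≤ n * n → m ≤ n
  m*m≤n*n⇒m≤n m*m≤n*n = ≮⇒≥ λ n<m → <⇒≱ (*-mono-< n<m n<m) m*m≤n*n

  m*m≡n*n⇒m≡n : m * m ≡ n * n → m ≡ n
  m*m≡n*n⇒m≡n eq = ≤-antisym (m*m≤n*n⇒m≤n (≤-reflexive eq)) (m*m≤n*n⇒m≤n (≤-reflexive (sym eq)))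

  m*n>0⇒m>0 : ∀ m n → 0 < m * n → 0 < m
  m*n>0⇒m>0 (suc m) n _ = z<s

  m*n>0⇒n>0 : ∀ m n → 0 < m * n → 0 < n
  m*n>0⇒n>0 m n m*n>0 = m*n>0⇒m>0 n m (subst (0 <_) (*-comm m n) m*n>0)

  m%2≡1⇒¬2∣m : m % 2 ≡ 1 → ¬ 2 ∣ m
  m%2≡1⇒¬2∣m {m} m%2≡1 2∣m = contradiction (trans (sym m%2≡1) (n∣m⇒m%n≡0 m 2 2∣m)) λ ()

  coprime-∣ : m ∣ x → n ∣ y → Coprime x y → Coprime m n
  coprime-∣ m∣x n∣y coprime (i∣m , i∣n) = coprime (∣-trans i∣m m∣x , ∣-trans i∣n n∣y)

  coprime-*ʳ : Coprime m n → Coprime m o → Coprime m (n * o)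
  coprime-*ʳ cmn cmo (i∣m , i∣no) = cmo (i∣m , coprime-divisor (coprime-∣ i∣m ∣-refl cmn) i∣no)

  coprime-*ˡ : Coprime m o → Coprime n o → Coprime (m * n) o
  coprime-*ˡ cmo cno = Coprime.sym (coprime-*ʳ (Coprime.sym cmo) (Coprime.sym cno))

  coprime-squares : Coprime m n → Coprime (m * m) (n * n)
  coprime-squares cmn = coprime-*ˡ cmn² cmn²
    where cmn² = coprime-*ʳ cmn cmn

  coprime-∣⇒≡1 : Coprime m n → m ∣ n → m ≡ 1
  coprime-∣⇒≡1 coprime m∣n = coprime (∣-refl , m∣n)

  ¬2∣⇒coprime-2 : ¬ 2 ∣ m → Coprime m 2
  ¬2∣⇒coprime-2 2∤m (i∣m , i∣2) with prime⇒irreducible prime[2] i∣2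
  ... | inj₁ i≡1  = i≡1
  ... | inj₂ refl = contradiction i∣m 2∤m

  divide-by-gcd : ∀ m n .{{_ : NonZero m}} →
                  Σ[ g ∈ ℕ ] Σ[ m′ ∈ ℕ ] Σ[ n′ ∈ ℕ ] 0 < g × m ≡ m′ * g × n ≡ n′ * g × Coprime m′ n′
  divide-by-gcd m n = g , m / g , n / g , n≢0⇒n>0 g≢0 ,
                      sym (m/n*n≡m (gcd[m,n]∣m m n)) , sym (m/n*n≡m (gcd[m,n]∣n m n)) , coprime-/gcd m n
    where
    g = gcd m n
    g≢0 = gcd[m,n]≢0 m n (inj₁ (≢-nonZero⁻¹ m))
    instance _ = ≢-nonZero g≢0

  -- With g = gcd x z: x divides gcd (z x) (z z) = z g, hence also gcd (g x) (g z) = g g;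
  -- conversely g g divides z z = y x and is coprime to y.
  gcd-square-factor : Coprime x y → x * y ≡ z * z → x ≡ gcd x z * gcd x z
  gcd-square-factor {x} {y} {z} coprime xy≡zz = ∣-antisym x∣gg gg∣x
    where
    g = gcd x z
    zz≡yx : z * z ≡ y * x
    zz≡yx = trans (sym xy≡zz) (*-comm x y)
    x∣zg : x ∣ z * g
    x∣zg = subst (x ∣_) (sym (c*gcd[m,n]≡gcd[cm,cn] z x z)) (gcd-greatest (n∣m*n z) (divides y zz≡yx))
    x∣gg : x ∣ g * g
    x∣gg = subst (x ∣_) (sym (c*gcd[m,n]≡gcd[cm,cn] g x z))
             (gcd-greatest (n∣m*n g) (subst (x ∣_) (*-comm z g) x∣zg))
    gg∣x : g * g ∣ x
    gg∣x = coprime-divisor (coprime-*ˡ gy gy) (subst (g * g ∣_) zz≡yx (*-pres-∣ (gcd[m,n]∣n x z) (gcd[m,n]∣n x z)))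
      where
      gy : Coprime g y
      gy = coprime-∣ (gcd[m,n]∣m x z) ∣-refl coprime

  opaque
    coprime-factors-square : Coprime x y → x * y ≡ z * z →
                             ∃₂ λ p q → x ≡ p * p × y ≡ q * q × z ≡ p * q × Coprime p q
    coprime-factors-square {x} {y} {z} coprime xy≡zz = gcd x z , gcd y z , x≡pp , y≡qq , z≡pq , coprime-pq
      where
      open ≡-Reasoning
      x≡pp : x ≡ gcd x z * gcd x z
      x≡pp = gcd-square-factor coprime xy≡zz
      y≡qq : y ≡ gcd y z * gcd y z
      y≡qq = gcd-square-factor (Coprime.sym coprime) (trans (*-comm y x) xy≡zz)
      z≡pq : z ≡ gcd x z * gcd y z
      z≡pq = m*m≡n*n⇒m≡n (begin
        z * z                                         ≡⟨ xy≡zz ⟨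
        x * y                                         ≡⟨ cong₂ _*_ x≡pp y≡qq ⟩
        (gcd x z * gcd x z) * (gcd y z * gcd y z)     ≡⟨ interchange (gcd x z) (gcd y z) (gcd x z) (gcd y z) ⟨
        (gcd x z * gcd y z) * (gcd x z * gcd y z)     ∎)
      coprime-pq : Coprime (gcd x z) (gcd y z)
      coprime-pq = coprime-∣ (m∣m*n (gcd x z)) (m∣m*n (gcd y z)) (subst₂ Coprime x≡pp y≡qq coprime)

  halve-coprime-factors : Coprime x y → x * y ≡ 2 * (z * z) → 2 ∣ x →
                          ∃₂ λ r s → x ≡ 2 * (r * r) × y ≡ s * s × z ≡ r * s × Coprime r s
  halve-coprime-factors {x} {y} {z} coprime xy≡2zz (divides k x≡k*2)
    with coprime-factors-square {k} {y} {z} (coprime-∣ (m∣m*n {k} 2) ∣-refl (subst (λ x → Coprime x y) x≡k*2 coprime)) ky≡zz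
    where
    ky≡zz : k * y ≡ z * z
    ky≡zz = *-cancelˡ-≡ (k * y) (z * z) 2 (trans (sym (*-assoc 2 k y))
              (trans (cong (_* y) (trans (*-comm 2 k) (sym x≡k*2))) xy≡2zz))
  ... | r , s , k≡rr , y≡ss , z≡rs , coprime-rs =
        r , s , trans x≡k*2 (trans (*-comm k 2) (cong (2 *_) k≡rr)) , y≡ss , z≡rs , coprime-rs

  coprime-factors-twice-square :
    Coprime x y → x * y ≡ 2 * (z * z) →
    (∃₂ λ r s → x ≡ 2 * (r * r) × y ≡ s * s × z ≡ r * s × Coprime r s) ⊎
    (∃₂ λ r s → x ≡ r * r × y ≡ 2 * (s * s) × z ≡ r * s × Coprime r s)
  coprime-factors-twice-square {x} {y} {z} coprime xy≡2zz
    with euclidsLemma x y prime[2] (divides (z * z) (trans xy≡2zz (*-comm 2 (z * z))))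
  ... | inj₁ 2∣x = inj₁ (halve-coprime-factors {x} {y} {z} coprime xy≡2zz 2∣x)
  ... | inj₂ 2∣y with halve-coprime-factors {y} {x} {z} (Coprime.sym coprime) (trans (*-comm y x) xy≡2zz) 2∣y
  ...   | r , s , y≡2rr , x≡ss , z≡rs , coprime-rs =
            inj₂ (s , r , x≡ss , y≡2rr , trans z≡rs (*-comm r s) , Coprime.sym coprime-rs)

  square-cancel : 0 < d → k * (d * d) ≡ e * e → ∃[ w ] k ≡ w * w
  square-cancel {d} {k} {e} d>0 eq with divide-by-gcd d e {{>-nonZero d>0}}
  ... | g , d′ , e′ , g>0 , refl , refl , coprime = e′ , k≡e′e′
    where
    instance _ = >-nonZero (*-mono-< g>0 g>0)
    kd′d′≡e′e′ : k * (d′ * d′) ≡ e′ * e′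
    kd′d′≡e′e′ = *-cancelʳ-≡ _ _ (g * g) (begin
      k * (d′ * d′) * (g * g)   ≡⟨ *-assoc k _ _ ⟩
      k * ((d′ * d′) * (g * g)) ≡⟨ cong (k *_) (interchange d′ g d′ g) ⟨
      k * ((d′ * g) * (d′ * g)) ≡⟨ eq ⟩
      (e′ * g) * (e′ * g)       ≡⟨ interchange e′ g e′ g ⟩
      (e′ * e′) * (g * g)       ∎)
      where open ≡-Reasoning
    d′d′≡1 : d′ * d′ ≡ 1
    d′d′≡1 = coprime-∣⇒≡1 (coprime-squares coprime) (divides k (sym kd′d′≡e′e′))
    k≡e′e′ : k ≡ e′ * e′
    k≡e′e′ = trans (sym (*-identityʳ k)) (trans (cong (k *_) (sym d′d′≡1)) kd′d′≡e′e′)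

  same-parity⇒≡+2* : x % 2 ≡ y % 2 → y ≤ x → ∃[ n ] x ≡ y + 2 * n
  same-parity⇒≡+2* {x} {y} x%2≡y%2 y≤x = x / 2 ∸ y / 2 , (begin
    x                                         ≡⟨ m≡m%n+[m/n]*n x 2 ⟩
    x % 2 + x / 2 * 2                         ≡⟨ cong₂ (λ r q → r + q * 2) x%2≡y%2 (sym (m+[n∸m]≡n (/-monoˡ-≤ 2 y≤x))) ⟩
    y % 2 + (y / 2 + (x / 2 ∸ y / 2)) * 2     ≡⟨ r+[q+n]*2≡r+q*2+2n (y % 2) (y / 2) (x / 2 ∸ y / 2) ⟩
    (y % 2 + y / 2 * 2) + 2 * (x / 2 ∸ y / 2) ≡⟨ cong (_+ 2 * (x / 2 ∸ y / 2)) (m≡m%n+[m/n]*n y 2) ⟨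
    y + 2 * (x / 2 ∸ y / 2)                   ∎)
    where open ≡-Reasoning

  opaque
    half-difference : Coprime x y → x % 2 ≡ y % 2 → x * x ≡ 4 * k + y * y →
                      ∃[ n ] x ≡ y + 2 * n × n * (y + n) ≡ k × Coprime n (y + n)
    half-difference {x} {y} {k} coprime x%2≡y%2 x²≡4k+y²
      with same-parity⇒≡+2* {x} {y} x%2≡y%2 (m*m≤n*n⇒m≤n (subst (y * y ≤_) (sym x²≡4k+y²) (m≤n+m (y * y) (4 * k))))
    ... | n , x≡y+2n = n , x≡y+2n , n[y+n]≡k , coprime-n
      where
      n[y+n]≡k : n * (y + n) ≡ k
      n[y+n]≡k = *-cancelˡ-≡ _ _ 4 (+-cancelʳ-≡ (y * y) _ _
                   (trans (sym ([y+2n]²≡4n[y+n]+y² y n)) (trans (cong (λ x → x * x) (sym x≡y+2n)) x²≡4k+y²)))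
      coprime-n : Coprime n (y + n)
      coprime-n {i} (i∣n , i∣y+n) = coprime (i∣x , i∣y)
        where
        i∣y : i ∣ y
        i∣y = ∣m+n∣m⇒∣n (subst (i ∣_) (+-comm y n) i∣y+n) i∣n
        i∣x : i ∣ x
        i∣x = subst (i ∣_) (sym x≡y+2n) (∣m∣n⇒∣m+n i∣y (∣n⇒∣m*n 2 i∣n))

  pythagorean-parametrisation : ∀ {c u v} → Coprime u v → u % 2 ≡ v % 2 → u * u ≡ 4 * (c * c) + v * v →
                                ∃₂ λ m n → Coprime m n × c ≡ m * n × u ≡ m * m + n * n
  pythagorean-parametrisation {c} {u} {v} coprime parity eq with half-difference {u} {v} {c * c} coprime parity eq
  ... | k , u≡v+2k , k[v+k]≡cc , coprime-k
    with coprime-factors-square {v + k} {k} {c} (Coprime.sym coprime-k) (trans (*-comm (v + k) k) k[v+k]≡cc)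
  ... | m , n , v+k≡mm , k≡nn , c≡mn , coprime-mn =
        m , n , coprime-mn , c≡mn , trans u≡v+2k (trans (y+2n≡[y+n]+n v k) (cong₂ _+_ v+k≡mm k≡nn))

  module Modulo (d : ℕ) .{{_ : NonZero d}} where

    -- A record rather than a plain `x % d ≡ y % d`, so that Agda can infer x and y.
    infix 4 _≈_
    record _≈_ (x y : ℕ) : Set where
      constructor mod≡
      field %≡% : x % d ≡ y % d
    open _≈_ public

    ≈-refl : x ≈ x
    ≈-refl = mod≡ refl

    ≈-sym : x ≈ y → y ≈ x
    ≈-sym (mod≡ eq) = mod≡ (sym eq)

    ≈-trans : x ≈ y → y ≈ z → x ≈ z
    ≈-trans (mod≡ eq) (mod≡ eq′) = mod≡ (trans eq eq′)

    ≡⇒≈ : x ≡ y → x ≈ y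
    ≡⇒≈ eq = mod≡ (cong (_% d) eq)

    +-cong : x ≈ y → z ≈ o → x + z ≈ y + o
    +-cong {x} {y} {z} {o} (mod≡ x≈y) (mod≡ z≈o) = mod≡ (trans (%-distribˡ-+ x z d)
      (trans (cong₂ (λ p q → (p + q) % d) x≈y z≈o) (sym (%-distribˡ-+ y o d))))

    *-cong : x ≈ y → z ≈ o → x * z ≈ y * o
    *-cong {x} {y} {z} {o} (mod≡ x≈y) (mod≡ z≈o) = mod≡ (trans (%-distribˡ-* x z d)
      (trans (cong₂ (λ p q → (p * q) % d) x≈y z≈o) (sym (%-distribˡ-* y o d))))

    *-congˡ : ∀ k → x ≈ y → k * x ≈ k * y
    *-congˡ k = *-cong (≈-refl {k})

    [_] : ℕ → ℕ
    [ x ] = toℕ (x mod d)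

    [x]≡x%d : ∀ x → [ x ] ≡ x % d
    [x]≡x%d x = toℕ-fromℕ< (m%n<n x d)

    x≈[x] : ∀ x → x ≈ [ x ]
    x≈[x] x = mod≡ (trans (sym (m%n%n≡m%n x d)) (cong (_% d) (sym ([x]≡x%d x))))

    x²≈[x]² : ∀ x → x * x ≈ [ x ] * [ x ]
    x²≈[x]² x = *-cong (x≈[x] x) (x≈[x] x)

    [x]%e≡x%e : ∀ {e} .{{_ : NonZero e}} → e ∣ d → ∀ x → [ x ] % e ≡ x % e
    [x]%e≡x%e {e} e∣d x = trans (cong (_% e) ([x]≡x%d x)) (m∣n⇒o%n%m≡o%m e d x e∣d)

    [x]%e≡0⇒e∣x : ∀ {e} .{{_ : NonZero e}} → e ∣ d → ∀ x → [ x ] % e ≡ 0 → e ∣ x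
    [x]%e≡0⇒e∣x {e} e∣d x [x]%e≡0 = m%n≡0⇒n∣m x e (trans (sym ([x]%e≡x%e e∣d x)) [x]%e≡0)

  opaque
    prime[3] : Prime 3
    prime[3] = from-yes (prime? 3)

    squares-mod-4 : ∀ (a b u v : Fin 4) → let A = toℕ a ; B = toℕ b ; U = toℕ u ; V = toℕ v in
      A * A % 4 ≡ (2 * (B * B) + U * U) % 4 → A * A % 4 ≡ (3 * (B * B) + V * V) % 4 →
      (A % 2 ≡ 0 × B % 2 ≡ 0) ⊎ (B % 2 ≡ 0 × A % 2 ≡ 1 × U % 2 ≡ 1 × V % 2 ≡ 1)
    squares-mod-4 = from-yes (all? λ (a : Fin 4) → all? λ (b : Fin 4) → all? λ (u : Fin 4) → all? λ (v : Fin 4) →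
      let A = toℕ a ; B = toℕ b ; U = toℕ u ; V = toℕ v in
      (A * A % 4 ≟ (2 * (B * B) + U * U) % 4) →-dec ((A * A % 4 ≟ (3 * (B * B) + V * V) % 4) →-dec
      (((A % 2 ≟ 0) ×-dec (B % 2 ≟ 0)) ⊎-dec ((B % 2 ≟ 0) ×-dec ((A % 2 ≟ 1) ×-dec ((U % 2 ≟ 1) ×-dec (V % 2 ≟ 1)))))))

    squares-mod-9 : ∀ (a v b : Fin 9) → let A = toℕ a ; V = toℕ v ; B = toℕ b in
      (A * A + V * V) % 9 ≡ 3 * (B * B) % 9 → A % 3 ≡ 0 × B % 3 ≡ 0
    squares-mod-9 = from-yes (all? λ (a : Fin 9) → all? λ (v : Fin 9) → all? λ (b : Fin 9) →
      let A = toℕ a ; V = toℕ v ; B = toℕ b in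
      ((A * A + V * V) % 9 ≟ 3 * (B * B) % 9) →-dec ((A % 3 ≟ 0) ×-dec (B % 3 ≟ 0)))

    squares-mod-3 : ∀ (r s m n : Fin 3) → let R = toℕ r ; S = toℕ s ; M = toℕ m ; N = toℕ n in
      (R * R + (M * M + N * N)) % 3 ≡ 2 * (S * S) % 3 → R * S % 3 ≡ M * N % 3 →
      (R % 3 ≡ 0 × S % 3 ≡ 0) ⊎ (M % 3 ≡ 0 × N % 3 ≡ 0)
    squares-mod-3 = from-yes (all? λ (r : Fin 3) → all? λ (s : Fin 3) → all? λ (m : Fin 3) → all? λ (n : Fin 3) →
      let R = toℕ r ; S = toℕ s ; M = toℕ m ; N = toℕ n in
      ((R * R + (M * M + N * N)) % 3 ≟ 2 * (S * S) % 3) →-dec ((R * S % 3 ≟ M * N % 3) →-dec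
      (((R % 3 ≟ 0) ×-dec (S % 3 ≟ 0)) ⊎-dec ((M % 3 ≟ 0) ×-dec (N % 3 ≟ 0)))))

  primitive-parity : Coprime x y → x * x ≡ 2 * (y * y) + z * z → x * x ≡ 3 * (y * y) + o * o →
                     2 ∣ y × x % 2 ≡ 1 × z % 2 ≡ 1 × o % 2 ≡ 1
  primitive-parity {x} {y} {z} {o} coprime eq₂ eq₃ =
    Sum.[ (λ (x-even , y-even) → contradiction (coprime (even x x-even , even y y-even)) λ ())
        , (λ (y-even , x-odd , z-odd , o-odd) → even y y-even , odd x x-odd , odd z z-odd , odd o o-odd)
        ]′ (squares-mod-4 (x mod 4) (y mod 4) (z mod 4) (o mod 4) (%≡% (reduce 2 x y z eq₂)) (%≡% (reduce 3 x y o eq₃)))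
    where
    open Modulo 4
    reduce : ∀ k a b c → a * a ≡ k * (b * b) + c * c → [ a ] * [ a ] ≈ k * ([ b ] * [ b ]) + [ c ] * [ c ]
    reduce k a b c eq = ≈-trans (≈-sym (x²≈[x]² a)) (≈-trans (≡⇒≈ eq) (+-cong (*-congˡ k (x²≈[x]² b)) (x²≈[x]² c)))
    even : ∀ a → [ a ] % 2 ≡ 0 → 2 ∣ a
    even = [x]%e≡0⇒e∣x (divides 2 refl)
    odd : ∀ a → [ a ] % 2 ≡ 1 → a % 2 ≡ 1
    odd a [a]%2≡1 = trans (sym ([x]%e≡x%e (divides 2 refl) a)) [a]%2≡1

  coprime⇒x²+y²≢3z² : Coprime x z → x * x + y * y ≢ 3 * (z * z)
  coprime⇒x²+y²≢3z² {x} {z} {y} coprime eq =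
    contradiction (coprime (Product.map (3∣ x) (3∣ z) (squares-mod-9 (x mod 9) (y mod 9) (z mod 9) (%≡% reduced)))) λ ()
    where
    open Modulo 9
    3∣ : ∀ a → [ a ] % 3 ≡ 0 → 3 ∣ a
    3∣ = [x]%e≡0⇒e∣x (divides 3 refl)
    reduced : [ x ] * [ x ] + [ y ] * [ y ] ≈ 3 * ([ z ] * [ z ])
    reduced = ≈-trans (≈-sym (+-cong (x²≈[x]² x) (x²≈[x]² y))) (≈-trans (≡⇒≈ eq) (*-congˡ 3 (x²≈[x]² z)))

  coprime⇒x²+[m²+n²]≢2y² : Coprime x y → Coprime m n → x * y ≡ m * n → x * x + (m * m + n * n) ≢ 2 * (y * y)
  coprime⇒x²+[m²+n²]≢2y² {x} {y} {m} {n} coprime-xy coprime-mn xy≡mn eq =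
    Sum.[ refute coprime-xy , refute coprime-mn ]′
      (squares-mod-3 (x mod 3) (y mod 3) (m mod 3) (n mod 3) (%≡% reduced-squares) (%≡% reduced-products))
    where
    open Modulo 3
    refute : ∀ {a b} → Coprime a b → [ a ] % 3 ≡ 0 × [ b ] % 3 ≡ 0 → ⊥
    refute {a} {b} coprime ([a]≡0 , [b]≡0) =
      contradiction (coprime ([x]%e≡0⇒e∣x ∣-refl a [a]≡0 , [x]%e≡0⇒e∣x ∣-refl b [b]≡0)) λ ()
    reduced-products : [ x ] * [ y ] ≈ [ m ] * [ n ]
    reduced-products = ≈-trans (≈-sym (*-cong (x≈[x] x) (x≈[x] y))) (≈-trans (≡⇒≈ xy≡mn) (*-cong (x≈[x] m) (x≈[x] n)))
    reduced-squares : [ x ] * [ x ] + ([ m ] * [ m ] + [ n ] * [ n ]) ≈ 2 * ([ y ] * [ y ])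
    reduced-squares = ≈-trans (≈-sym (+-cong (x²≈[x]² x) (+-cong (x²≈[x]² m) (x²≈[x]² n))))
                        (≈-trans (≡⇒≈ eq) (*-congˡ 2 (x²≈[x]² y)))

  opaque
    four-number-lemma : ∀ {x y m n} → 0 < x → x * y ≡ m * n →
      Σ[ α ∈ ℕ ] Σ[ β ∈ ℕ ] Σ[ γ ∈ ℕ ] Σ[ δ ∈ ℕ ]
        0 < α × x ≡ γ * α × m ≡ β * α × n ≡ δ * γ × y ≡ β * δ × Coprime β γ
    four-number-lemma {x} {y} {m} {n} x>0 xy≡mn with divide-by-gcd x m {{>-nonZero x>0}}
    ... | α , γ , β , α>0 , x≡γα , m≡βα , coprime-γβ =
          α , β , γ , quotient γ∣n , α>0 , x≡γα , m≡βα , n≡δγ , y≡βδ , Coprime.sym coprime-γβ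
      where
      open ≡-Reasoning
      γy≡βn : γ * y ≡ β * n
      γy≡βn = *-cancelʳ-≡ (γ * y) (β * n) α {{>-nonZero α>0}} (begin
        γ * y * α ≡⟨ xy∙z≈xz∙y γ y α ⟩
        γ * α * y ≡⟨ cong (_* y) x≡γα ⟨
        x * y     ≡⟨ xy≡mn ⟩
        m * n     ≡⟨ cong (_* n) m≡βα ⟩
        β * α * n ≡⟨ xy∙z≈xz∙y β α n ⟩
        β * n * α ∎)
      γ∣n : γ ∣ n
      γ∣n = coprime-divisor coprime-γβ (divides y (trans (sym γy≡βn) (*-comm γ y)))
      n≡δγ : n ≡ quotient γ∣n * γ
      n≡δγ = m∣n⇒n≡quotient*m γ∣n
      y≡βδ : y ≡ β * quotient γ∣n
      y≡βδ = *-cancelˡ-≡ y (β * quotient γ∣n) γ {{>-nonZero (m*n>0⇒m>0 γ α (subst (0 <_) x≡γα x>0))}} (begin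
        γ * y                  ≡⟨ γy≡βn ⟩
        β * n                  ≡⟨ cong (β *_) n≡δγ ⟩
        β * (quotient γ∣n * γ) ≡⟨ x∙yz≈z∙xy β (quotient γ∣n) γ ⟩
        γ * (β * quotient γ∣n) ∎)

  -- B (D ∸ A) = C (D + 2 A) with B, C coprime, so D ∸ A = l C and l B = D + 2 A = l C + 3 A;
  -- then l divides 3 A and is coprime to A.
  ratio-is-1-or-3 : ∀ {A B C D} → 0 < B → 0 < C → Coprime B C → Coprime A D →
                    B * D ≡ B * A + C * (D + 2 * A) →
                    ∃[ l ] (l ≡ 1 ⊎ l ≡ 3) × D ≡ A + l * C × l * B ≡ l * C + 3 * A
  ratio-is-1-or-3 {A} {B} {C} {D} B>0 C>0 coprime-BC coprime-AD eq =
    l , prime⇒irreducible prime[3] l∣3 , D≡A+lC , lB≡lC+3A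
    where
    open ≡-Reasoning
    instance
      _ = >-nonZero B>0
      _ = >-nonZero C>0
    A≤D : A ≤ D
    A≤D = *-cancelˡ-≤ B (subst (B * A ≤_) (sym eq) (m≤m+n (B * A) _))
    E = D ∸ A
    D≡A+E : D ≡ A + E
    D≡A+E = sym (m+[n∸m]≡n A≤D)
    BE≡C[D+2A] : B * E ≡ C * (D + 2 * A)
    BE≡C[D+2A] = +-cancelˡ-≡ (B * A) _ _ (begin
      B * A + B * E           ≡⟨ *-distribˡ-+ B A E ⟨
      B * (A + E)             ≡⟨ cong (B *_) D≡A+E ⟨
      B * D                   ≡⟨ eq ⟩
      B * A + C * (D + 2 * A) ∎)
    C∣E : C ∣ E
    C∣E = coprime-divisor (Coprime.sym coprime-BC) (divides (D + 2 * A) (trans BE≡C[D+2A] (*-comm C _)))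
    l = quotient C∣E
    E≡lC : E ≡ l * C
    E≡lC = m∣n⇒n≡quotient*m C∣E
    lB≡D+2A : l * B ≡ D + 2 * A
    lB≡D+2A = *-cancelˡ-≡ (l * B) (D + 2 * A) C (begin
      C * (l * B)     ≡⟨ x∙yz≈z∙yx C l B ⟩
      B * (l * C)     ≡⟨ cong (B *_) E≡lC ⟨
      B * E           ≡⟨ BE≡C[D+2A] ⟩
      C * (D + 2 * A) ∎)
    D≡A+lC : D ≡ A + l * C
    D≡A+lC = trans D≡A+E (cong (A +_) E≡lC)
    lB≡lC+3A : l * B ≡ l * C + 3 * A
    lB≡lC+3A = begin
      l * B             ≡⟨ lB≡D+2A ⟩
      D + 2 * A         ≡⟨ cong (_+ 2 * A) D≡A+lC ⟩
      A + l * C + 2 * A ≡⟨ x+y+2x≡y+3x A (l * C) ⟩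
      l * C + 3 * A     ∎
    coprime-lA : Coprime l A
    coprime-lA {i} (i∣l , i∣A) = coprime-AD (i∣A , subst (i ∣_) (sym D≡A+lC) (∣m∣n⇒∣m+n i∣A (∣m⇒∣m*n C i∣l)))
    l∣3 : l ∣ 3
    l∣3 = coprime-divisor coprime-lA (subst (l ∣_) (*-comm 3 A)
            (∣m+n∣m⇒∣n (subst (l ∣_) lB≡lC+3A (m∣m*n B)) (m∣m*n C)))

  record PrimitiveSolution (b : ℕ) : Set where
    constructor solution
    field
      a u v     : ℕ
      coprime   : Coprime a b
      a²≡2b²+u² : a * a ≡ 2 * (b * b) + u * u
      a²≡3b²+v² : a * a ≡ 3 * (b * b) + v * v

  ratio-1-solution : ∀ {α β γ δ} → Coprime α δ → δ * δ ≡ α * α + 1 * (γ * γ) →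
                     1 * (β * β) ≡ 1 * (γ * γ) + 3 * (α * α) → PrimitiveSolution α
  ratio-1-solution {α} {β} {γ} {δ} coprime-αδ D≡A+C B≡C+3A = solution β δ γ coprime-βα B≡2A+D B≡3A+C
    where
    open ≡-Reasoning
    A = α * α
    B = β * β
    C = γ * γ
    D = δ * δ
    B≡3A+C : B ≡ 3 * A + C
    B≡3A+C = trans (sym (*-identityˡ B)) (trans B≡C+3A (trans (cong (_+ 3 * A) (*-identityˡ C)) (+-comm C (3 * A))))
    B≡2A+D : B ≡ 2 * A + D
    B≡2A+D = begin
      B                   ≡⟨ B≡3A+C ⟩
      3 * A + C           ≡⟨ 3x+y≡2x+[x+y] A C ⟩
      2 * A + (A + C)     ≡⟨ cong (λ c → 2 * A + (A + c)) (*-identityˡ C) ⟨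
      2 * A + (A + 1 * C) ≡⟨ cong (2 * A +_) D≡A+C ⟨
      2 * A + D           ∎
    coprime-βα : Coprime β α
    coprime-βα {i} (i∣β , i∣α) = coprime-*ʳ coprime-αδ coprime-αδ (i∣α , i∣D)
      where
      i∣D : i ∣ D
      i∣D = ∣m+n∣m⇒∣n (subst (i ∣_) B≡2A+D (∣m⇒∣m*n β i∣β)) (∣n⇒∣m*n 2 (∣m⇒∣m*n α i∣α))

  ratio-3-solution : ∀ {α β γ δ} → Coprime β γ → δ * δ ≡ α * α + 3 * (γ * γ) →
                     3 * (β * β) ≡ 3 * (γ * γ) + 3 * (α * α) → PrimitiveSolution γ
  ratio-3-solution {α} {β} {γ} {δ} coprime-βγ D≡A+3C 3B≡3C+3A = solution δ β α coprime-δγ D≡2C+B D≡3C+A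
    where
    open ≡-Reasoning
    A = α * α
    B = β * β
    C = γ * γ
    D = δ * δ
    B≡C+A : B ≡ C + A
    B≡C+A = *-cancelˡ-≡ B (C + A) 3 (trans 3B≡3C+3A (sym (*-distribˡ-+ 3 C A)))
    D≡3C+A : D ≡ 3 * C + A
    D≡3C+A = trans D≡A+3C (+-comm A (3 * C))
    D≡2C+B : D ≡ 2 * C + B
    D≡2C+B = begin
      D               ≡⟨ D≡3C+A ⟩
      3 * C + A       ≡⟨ 3x+y≡2x+[x+y] C A ⟩
      2 * C + (C + A) ≡⟨ cong (2 * C +_) B≡C+A ⟨
      2 * C + B       ∎
    coprime-δγ : Coprime δ γ
    coprime-δγ {i} (i∣δ , i∣γ) = coprime-*ʳ (Coprime.sym coprime-βγ) (Coprime.sym coprime-βγ) (i∣γ , i∣B)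
      where
      i∣B : i ∣ B
      i∣B = ∣m+n∣m⇒∣n (subst (i ∣_) D≡2C+B (∣m⇒∣m*n δ i∣δ)) (∣n⇒∣m*n 2 (∣m⇒∣m*n γ i∣γ))

  opaque
    descended-solution : ∀ {α β γ δ} → 0 < β → 0 < γ → Coprime β γ → Coprime α δ →
      (β * δ) * (β * δ) ≡ 2 * ((γ * α) * (γ * α)) + ((β * α) * (β * α) + (δ * γ) * (δ * γ)) →
      PrimitiveSolution α ⊎ PrimitiveSolution γ
    descended-solution {α} {β} {γ} {δ} β>0 γ>0 coprime-βγ coprime-αδ eq =
      by-ratio (ratio-is-1-or-3 (*-mono-< β>0 β>0) (*-mono-< γ>0 γ>0) (coprime-squares coprime-βγ) (coprime-squares coprime-αδ)
                 (trans (sym (interchange β δ β δ)) (trans eq (four-number-expansion α β γ δ))))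
      where
      by-ratio : ∃[ l ] (l ≡ 1 ⊎ l ≡ 3) × δ * δ ≡ α * α + l * (γ * γ) × l * (β * β) ≡ l * (γ * γ) + 3 * (α * α) →
                 PrimitiveSolution α ⊎ PrimitiveSolution γ
      by-ratio (_ , inj₁ refl , D≡A+C , B≡C+3A) = inj₁ (ratio-1-solution {α} {β} {γ} {δ} coprime-αδ D≡A+C B≡C+3A)
      by-ratio (_ , inj₂ refl , D≡A+3C , B≡C+A) = inj₂ (ratio-3-solution {α} {β} {γ} {δ} coprime-βγ D≡A+3C B≡C+A)

  smaller-solution : ∀ {m n r s} → 0 < m * n → Coprime m n → r * s ≡ m * n → s * s ≡ 2 * (r * r) + (m * m + n * n) →
                     Σ[ b′ ∈ ℕ ] 0 < b′ × b′ ∣ m * n × PrimitiveSolution b′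
  smaller-solution {m} {n} {r} {s} mn>0 coprime-mn rs≡mn eq
    with four-number-lemma {r} {s} {m} {n} (m*n>0⇒m>0 r s (subst (0 <_) (sym rs≡mn) mn>0)) rs≡mn
  ... | α , β , γ , δ , α>0 , refl , refl , refl , refl , coprime-βγ
    with m*n>0⇒n>0 δ γ (m*n>0⇒n>0 (β * α) (δ * γ) mn>0)
  ... | γ>0
    with descended-solution {α} {β} {γ} {δ} (m*n>0⇒m>0 β α (m*n>0⇒m>0 (β * α) (δ * γ) mn>0)) γ>0
           coprime-βγ (coprime-∣ (n∣m*n β) (m∣m*n γ) coprime-mn) eq
  ... | inj₁ solution-α = α , α>0 , ∣m⇒∣m*n (δ * γ) (n∣m*n β) , solution-α
  ... | inj₂ solution-γ = γ , γ>0 , ∣n⇒∣m*n (β * α) (n∣m*n δ) , solution-γ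

  u²≡b²+v² : ∀ {a b u v} → a * a ≡ 2 * (b * b) + u * u → a * a ≡ 3 * (b * b) + v * v → u * u ≡ b * b + v * v
  u²≡b²+v² {a} {b} {u} {v} eq₂ eq₃ = +-cancelˡ-≡ (2 * (b * b)) _ _ (trans (sym eq₂) (trans eq₃ (3x+y≡2x+[x+y] (b * b) (v * v))))

  coprime-legs : ∀ {a b u v} → Coprime a b → a * a ≡ 3 * (b * b) + v * v → u * u ≡ b * b + v * v → Coprime u v
  coprime-legs {a} {b} {u} {v} coprime eq₃ u²≡b²+v² {i} (i∣u , i∣v) = coprime-squares coprime (i∣aa , i∣bb)
    where
    i∣vv : i ∣ v * v
    i∣vv = ∣m⇒∣m*n v i∣v
    i∣bb : i ∣ b * b
    i∣bb = ∣m+n∣m⇒∣n (subst (i ∣_) (trans u²≡b²+v² (+-comm (b * b) (v * v))) (∣m⇒∣m*n u i∣u)) i∣vv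
    i∣aa : i ∣ a * a
    i∣aa = subst (i ∣_) (sym eq₃) (∣m∣n⇒∣m+n (∣n⇒∣m*n 3 i∣bb) i∣vv)

  coprime-hypotenuse-leg : ∀ {a b u} → Coprime a b → ¬ 2 ∣ a → a * a ≡ 2 * (b * b) + u * u → Coprime a u
  coprime-hypotenuse-leg {a} {b} {u} coprime 2∤a eq₂ {i} (i∣a , i∣u) = coprime-*ʳ coprime coprime (i∣a , i∣bb)
    where
    i∣2bb : i ∣ 2 * (b * b)
    i∣2bb = ∣m+n∣m⇒∣n (subst (i ∣_) (trans eq₂ (+-comm _ (u * u))) (∣m⇒∣m*n a i∣a)) (∣m⇒∣m*n u i∣u)
    i∣bb : i ∣ b * b
    i∣bb = coprime-divisor (coprime-∣ i∣a ∣-refl (¬2∣⇒coprime-2 2∤a)) i∣2bb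

  primitive-solution⇒factorisation :
    ∀ {a b u v} → Coprime a b → a * a ≡ 2 * (b * b) + u * u → a * a ≡ 3 * (b * b) + v * v →
    Σ[ m ∈ ℕ ] Σ[ n ∈ ℕ ] Σ[ r ∈ ℕ ] Σ[ s ∈ ℕ ] b ≡ m * n * 2 × Coprime m n × Coprime r s × r * s ≡ m * n ×
      (s * s ≡ 2 * (r * r) + (m * m + n * n) ⊎ r * r + (m * m + n * n) ≡ 2 * (s * s))
  primitive-solution⇒factorisation {a} {b} {u} {v} coprime eq₂ eq₃
    with primitive-parity {a} {b} {u} {v} coprime eq₂ eq₃
  ... | divides c refl , a-odd , u-odd , v-odd
    with pythagorean-parametrisation {c} {u} {v}
           (coprime-legs {a} {c * 2} {u} {v} coprime eq₃ (u²≡b²+v² {a} {c * 2} {u} {v} eq₂ eq₃))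
           (trans u-odd (sym v-odd))
           (trans (u²≡b²+v² {a} {c * 2} {u} {v} eq₂ eq₃) (cong (_+ v * v) ([c*2]²≡4c² c)))
  ... | m , n , coprime-mn , refl , refl
    with half-difference {a} {m * m + n * n} {2 * ((m * n) * (m * n))}
           (coprime-hypotenuse-leg {a} {m * n * 2} {m * m + n * n} coprime (m%2≡1⇒¬2∣m a-odd) eq₂)
           (trans a-odd (sym u-odd))
           (trans eq₂ (cong (_+ (m * m + n * n) * (m * m + n * n)) (2[c*2]²≡4[2c²] (m * n))))
  ... | p , _ , p[u+p]≡2cc , coprime-p
    with coprime-factors-twice-square {p} {m * m + n * n + p} {m * n} coprime-p p[u+p]≡2cc
  ... | inj₁ (r , s , p≡2rr , u+p≡ss , mn≡rs , coprime-rs) =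
        m , n , r , s , refl , coprime-mn , coprime-rs , sym mn≡rs ,
        inj₁ (trans (sym u+p≡ss) (trans (cong (m * m + n * n +_) p≡2rr) (+-comm (m * m + n * n) _)))
  ... | inj₂ (r , s , p≡rr , u+p≡2ss , mn≡rs , coprime-rs) =
        m , n , r , s , refl , coprime-mn , coprime-rs , sym mn≡rs ,
        inj₂ (trans (+-comm (r * r) _) (trans (cong (m * m + n * n +_) (sym p≡rr)) u+p≡2ss))

  descent-step : 0 < b → PrimitiveSolution b → Σ[ b′ ∈ ℕ ] 0 < b′ × b′ < b × PrimitiveSolution b′
  descent-step {b} b>0 (solution a u v coprime eq₂ eq₃) with primitive-solution⇒factorisation {a} {b} {u} {v} coprime eq₂ eq₃
  ... | m , n , r , s , refl , coprime-mn , coprime-rs , rs≡mn , inj₂ eq =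
        ⊥-elim (coprime⇒x²+[m²+n²]≢2y² coprime-rs coprime-mn rs≡mn eq)
  ... | m , n , r , s , refl , coprime-mn , _ , rs≡mn , inj₁ eq =
        Product.map₂ (Product.map₂ (Product.map₁ divisor<b)) (smaller-solution {m} {n} {r} {s} mn>0 coprime-mn rs≡mn eq)
    where
    mn>0 : 0 < m * n
    mn>0 = m*n>0⇒m>0 (m * n) 2 b>0
    divisor<b : ∀ {b′} → b′ ∣ m * n → b′ < m * n * 2
    divisor<b b′∣mn = ≤-<-trans (∣⇒≤ {{>-nonZero mn>0}} b′∣mn) (m<m*n (m * n) 2 {{>-nonZero mn>0}} ≤-refl)

  no-primitive-solution : 0 < b → ¬ PrimitiveSolution b
  no-primitive-solution {b} = <-rec (λ b → 0 < b → ¬ PrimitiveSolution b) descend b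
    where
    descend : ∀ b → (∀ {b′} → b′ < b → 0 < b′ → ¬ PrimitiveSolution b′) → 0 < b → ¬ PrimitiveSolution b
    descend b smaller b>0 S with descent-step b>0 S
    ... | b′ , b′>0 , b′<b , S′ = smaller b′<b b′>0 S′

  no-square-above-3b² : ∀ {a p w} → Coprime a b → 0 < b → a * a ≡ p + 3 * (b * b) → (p + b * b) * p ≡ w * w → ⊥
  no-square-above-3b² {b} {a} {p} {w} coprime b>0 eq eq′ with coprime-factors-square {p + b * b} {p} {w} coprime-p eq′
    where
    coprime-p : Coprime (p + b * b) p
    coprime-p {i} (i∣p+bb , i∣p) = coprime-squares coprime (i∣aa , i∣bb)
      where
      i∣bb : i ∣ b * b
      i∣bb = ∣m+n∣m⇒∣n i∣p+bb i∣p
      i∣aa : i ∣ a * a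
      i∣aa = subst (i ∣_) (sym eq) (∣m∣n⇒∣m+n i∣p (∣n⇒∣m*n 3 i∣bb))
  ... | u , v , p+bb≡uu , p≡vv , _ = no-primitive-solution b>0 (solution a u v coprime
        (trans eq (trans (x+3y≡2y+[x+y] p (b * b)) (cong (2 * (b * b) +_) p+bb≡uu)))
        (trans eq (trans (+-comm p _) (cong (3 * (b * b) +_) p≡vv))))

  no-square-below-2b² : ∀ {a p w} → Coprime a b → a * a + p ≡ 2 * (b * b) → p * (p + b * b) ≡ w * w → ⊥
  no-square-below-2b² {b} {a} {p} {w} coprime eq eq′ with coprime-factors-square {p} {p + b * b} {w} coprime-p eq′
    where
    coprime-p : Coprime p (p + b * b)
    coprime-p {i} (i∣p , i∣p+bb) = coprime-squares coprime (i∣aa , i∣bb)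
      where
      i∣bb : i ∣ b * b
      i∣bb = ∣m+n∣m⇒∣n i∣p+bb i∣p
      i∣aa : i ∣ a * a
      i∣aa = ∣m+n∣m⇒∣n (subst (i ∣_) (trans (sym eq) (+-comm _ p)) (∣n⇒∣m*n 2 i∣bb)) i∣p
  ... | _ , v , _ , p+bb≡vv , _ = coprime⇒x²+y²≢3z² {y = v} coprime (begin
      a * a + v * v       ≡⟨ cong (a * a +_) p+bb≡vv ⟨
      a * a + (p + b * b) ≡⟨ +-assoc (a * a) p _ ⟨
      a * a + p + b * b   ≡⟨ cong (_+ b * b) eq ⟩
      2 * (b * b) + b * b ≡⟨ +-comm _ (b * b) ⟩
      3 * (b * b)         ∎)
    where open ≡-Reasoning

module Integers where

  open import Data.Integer.Base using (ℤ; +_; -[1+_]; +[1+_]; ∣_∣; _+_; _-_; _*_; -_)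
  import Data.Integer.Properties as ℤ
  open import Data.Integer.Tactic.RingSolver using (solve-∀)
  open import Data.Nat.Base as ℕ using (ℕ; zero; suc)
  import Data.Nat.Properties as ℕ
  open import Data.Nat.Coprimality using (Coprime)
  open import Data.Product using (∃-syntax; _×_; _,_)
  open import Data.Sum using (_⊎_; inj₁; inj₂)
  open import Relation.Binary.PropositionalEquality using (_≡_; _≢_; refl; sym; trans; cong; module ≡-Reasoning)
  open import Relation.Nullary using (yes; no; contradiction)
  open Naturals using (square-cancel; no-square-above-3b²; no-square-below-2b²)

  opaque
    x≡[x-y]+y : ∀ x y → x ≡ (x - y) + y
    x≡[x-y]+y = solve-∀

    x+z≡[x-y+z]+y : ∀ x y z → x + z ≡ ((x - y) + z) + y
    x+z≡[x-y+z]+y = solve-∀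

    -z+z+y≡y : ∀ z y → ((- z) + z) + y ≡ y
    -z+z+y≡y = solve-∀

    x-2y≡[x-3y]+y : ∀ x y → x - + 2 * y ≡ (x - + 3 * y) + y
    x-2y≡[x-3y]+y = solve-∀

    [x-2y][x-3y]≡[[x-3y]+y][x-3y] : ∀ x y → (x - + 2 * y) * (x - + 3 * y) ≡ ((x - + 3 * y) + y) * (x - + 3 * y)
    [x-2y][x-3y]≡[[x-3y]+y][x-3y] = solve-∀

  i*i≡+∣i∣*∣i∣ : ∀ i → i * i ≡ + (∣ i ∣ ℕ.* ∣ i ∣)
  i*i≡+∣i∣*∣i∣ (+ n)    = sym (ℤ.pos-* n n)
  i*i≡+∣i∣*∣i∣ -[1+ n ] = refl

  -[p]*-[1+k]≡+p*[1+k] : ∀ p k → (- + p) * -[1+ k ] ≡ + (p ℕ.* suc k)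
  -[p]*-[1+k]≡+p*[1+k] zero    k = refl
  -[p]*-[1+k]≡+p*[1+k] (suc p) k = refl

  +p*-[1+k]≢+n : ∀ {p} k n → 0 ℕ.< p → + p * -[1+ k ] ≢ + n
  +p*-[1+k]≢+n {suc p} k n _ ()

  +m-+n≡+p⇒m≡p+n : ∀ {m n p} → + m - + n ≡ + p → m ≡ p ℕ.+ n
  +m-+n≡+p⇒m≡p+n {m} {n} {p} eq = ℤ.+-injective (trans (x≡[x-y]+y (+ m) (+ n)) (cong (_+ + n) eq))

  +m-+n≡-+p⇒m+p≡n : ∀ {m n p} → + m - + n ≡ - + p → m ℕ.+ p ≡ n
  +m-+n≡-+p⇒m+p≡n {m} {n} {p} eq = ℤ.+-injective (begin
    + m + + p                 ≡⟨ x+z≡[x-y+z]+y (+ m) (+ n) (+ p) ⟩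
    ((+ m - + n) + + p) + + n ≡⟨ cong (λ x → (x + + p) + + n) eq ⟩
    ((- + p) + + p) + + n     ≡⟨ -z+z+y≡y (+ p) (+ n) ⟩
    + n                       ∎)
    where open ≡-Reasoning

  [y+m]*y≡+n⇒y≥0∨y+m≤0 : ∀ y m n → (y + + m) * y ≡ + n →
    (∃[ p ] y ≡ + p × (p ℕ.+ m) ℕ.* p ≡ n) ⊎ (∃[ p ] y + + m ≡ - + p × p ℕ.* (p ℕ.+ m) ≡ n)
  [y+m]*y≡+n⇒y≥0∨y+m≤0 (+ p) m n eq = inj₁ (p , refl , ℤ.+-injective (trans (ℤ.pos-* (p ℕ.+ m) p) eq))
  [y+m]*y≡+n⇒y≥0∨y+m≤0 -[1+ k ] m n eq with m ℕ.≤? suc k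
  ... | yes m≤1+k = inj₂ (suc k ℕ.∸ m , ℤ.⊖-≤ m≤1+k , (begin
    (suc k ℕ.∸ m) ℕ.* ((suc k ℕ.∸ m) ℕ.+ m) ≡⟨ cong ((suc k ℕ.∸ m) ℕ.*_) (ℕ.m∸n+n≡m m≤1+k) ⟩
    (suc k ℕ.∸ m) ℕ.* suc k                 ≡⟨ ℤ.+-injective (trans (sym (-[p]*-[1+k]≡+p*[1+k] (suc k ℕ.∸ m) k))
                                                  (trans (cong (_* -[1+ k ]) (sym (ℤ.⊖-≤ m≤1+k))) eq)) ⟩
    n                                       ∎))
    where open ≡-Reasoning
  ... | no m≰1+k = contradiction (trans (cong (_* -[1+ k ]) (sym (ℤ.⊖-≥ (ℕ.<⇒≤ 1+k<m)))) eq)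
                                 (+p*-[1+k]≢+n k n (ℕ.m<n⇒0<n∸m 1+k<m))
    where
    1+k<m : suc k ℕ.< m
    1+k<m = ℕ.≰⇒> m≰1+k

  [X-2Y][X-3Y]≡+n⇒X≥3Y∨X≤2Y : ∀ X Y n → (+ X - + 2 * + Y) * (+ X - + 3 * + Y) ≡ + n →
    (∃[ p ] X ≡ p ℕ.+ 3 ℕ.* Y × (p ℕ.+ Y) ℕ.* p ≡ n) ⊎ (∃[ p ] X ℕ.+ p ≡ 2 ℕ.* Y × p ℕ.* (p ℕ.+ Y) ≡ n)
  [X-2Y][X-3Y]≡+n⇒X≥3Y∨X≤2Y X Y n eq
    with [y+m]*y≡+n⇒y≥0∨y+m≤0 (+ X - + 3 * + Y) Y n (trans (sym ([x-2y][x-3y]≡[[x-3y]+y][x-3y] (+ X) (+ Y))) eq)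
  ... | inj₁ (p , y≡+p , eq′) = inj₁ (p , +m-+n≡+p⇒m≡p+n (trans (cong (_-_ (+ X)) (ℤ.pos-* 3 Y)) y≡+p) , eq′)
  ... | inj₂ (p , y+Y≡-p , eq′) = inj₂ (p , +m-+n≡-+p⇒m+p≡n
          (trans (cong (_-_ (+ X)) (ℤ.pos-* 2 Y)) (trans (x-2y≡[x-3y]+y (+ X) (+ Y)) y+Y≡-p)) , eq′)

  integer-square-cancel : ∀ k d e → k * (+[1+ d ] * +[1+ d ]) ≡ e * e → ∃[ w ] k ≡ + (w ℕ.* w)
  integer-square-cancel (+ k) d e eq
    with square-cancel {suc d} {k} {∣ e ∣} ℕ.z<s (ℤ.+-injective (trans (ℤ.pos-* k _) (trans eq (i*i≡+∣i∣*∣i∣ e))))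
  ... | w , k≡ww = w , cong +_ k≡ww
  integer-square-cancel -[1+ k ] d e eq = contradiction (trans eq (i*i≡+∣i∣*∣i∣ e)) λ ()

  -- B⁴ (t² − 2) (t² − 3) for t = A / B.
  quartic : ℤ → ℤ → ℤ
  quartic A B = (A * A - + 2 * (B * B)) * (A * A - + 3 * (B * B))

  quartic≢square : ∀ A b w → Coprime ∣ A ∣ (suc b) → quartic A +[1+ b ] ≢ + (w ℕ.* w)
  quartic≢square A b w coprime eq
    with [X-2Y][X-3Y]≡+n⇒X≥3Y∨X≤2Y (∣ A ∣ ℕ.* ∣ A ∣) (suc b ℕ.* suc b) (w ℕ.* w)
           (trans (cong (λ x → (x - + 2 * (+[1+ b ] * +[1+ b ])) * (x - + 3 * (+[1+ b ] * +[1+ b ])))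
                        (sym (i*i≡+∣i∣*∣i∣ A))) eq)
  ... | inj₁ (p , X≡p+3Y , eq′) = no-square-above-3b² {w = w} coprime ℕ.z<s X≡p+3Y eq′
  ... | inj₂ (p , X+p≡2Y , eq′) = no-square-below-2b² {w = w} coprime X+p≡2Y eq′

open import Defs
open import Data.Integer using (+_)
open import Data.Rational using (ℚ; _*_; _-_; _/_)
open import Relation.Binary.PropositionalEquality using (_≡_)
open import Relation.Nullary using (¬_)

import Data.Integer as ℤ
open import Data.Integer.Tactic.RingSolver using (solve-∀)
open import Data.Nat.Coprimality using (recompute)
open import Data.Product using (_,_)
open import Data.Rational.Base using (mkℚ; ↥_; ↧_; toℚᵘ; -_)
import Data.Rational.Properties as ℚ
open import Data.Rational.Unnormalised using (mkℚᵘ) renaming (_*_ to _*ᵘ_; _-_ to _-ᵘ_; _≃_ to _≃ᵘ_)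
import Data.Rational.Unnormalised.Properties as ℚᵘ
open import Relation.Binary.PropositionalEquality using (sym; trans)
open Integers using (quartic; quartic≢square; integer-square-cancel)

toℚᵘ-homo-minus : ∀ p r → toℚᵘ (p - r) ≃ᵘ toℚᵘ p -ᵘ toℚᵘ r
toℚᵘ-homo-minus p r = ℚᵘ.≃-trans (ℚ.toℚᵘ-homo-+ p (- r)) (ℚᵘ.+-congʳ (toℚᵘ p) (ℚ.toℚᵘ-homo‿- r))

opaque
  quartic-cross-multiplied : ∀ A S D →
    (A ℤ.* A ℤ.- + 2 ℤ.* (S ℤ.* S)) ℤ.* (A ℤ.* A ℤ.- + 3 ℤ.* (S ℤ.* S)) ℤ.* (D ℤ.* D) ≡
    ((A ℤ.* A ℤ.* + 1 ℤ.+ ℤ.- (+ 2) ℤ.* (S ℤ.* S)) ℤ.* (A ℤ.* A ℤ.* + 1 ℤ.+ ℤ.- (+ 3) ℤ.* (S ℤ.* S))) ℤ.* (D ℤ.* D)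
  quartic-cross-multiplied = solve-∀

  square-cross-multiplied : ∀ C S →
    (C ℤ.* C) ℤ.* ((S ℤ.* S ℤ.* + 1) ℤ.* (S ℤ.* S ℤ.* + 1)) ≡ (C ℤ.* (S ℤ.* S)) ℤ.* (C ℤ.* (S ℤ.* S))
  square-cross-multiplied = solve-∀

-- ℚ and ℚᵘ have no eta, so t and q are matched for the cross-multiplied numerators to compute.
clear-denominators : ∀ t q → q * q ≡ (t * t - + 2 / 1) * (t * t - + 3 / 1) →
                     quartic (↥ t) (↧ t) ℤ.* (↧ q ℤ.* ↧ q) ≡ (↥ q ℤ.* (↧ t ℤ.* ↧ t)) ℤ.* (↥ q ℤ.* (↧ t ℤ.* ↧ t))
clear-denominators t@(mkℚ _ _ _) q@(mkℚ _ _ _) eq = trans (quartic-cross-multiplied (↥ t) (↧ t) (↧ q))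
  (trans (sym (ℚᵘ.drop-*≡* unnormalised)) (square-cross-multiplied (↥ q) (↧ t)))
  where
  open ℚᵘ.≃-Reasoning
  unnormalised : toℚᵘ q *ᵘ toℚᵘ q ≃ᵘ (toℚᵘ t *ᵘ toℚᵘ t -ᵘ mkℚᵘ (+ 2) 0) *ᵘ (toℚᵘ t *ᵘ toℚᵘ t -ᵘ mkℚᵘ (+ 3) 0)
  unnormalised = begin
    toℚᵘ q *ᵘ toℚᵘ q                                     ≈⟨ ℚᵘ.≃-sym (ℚ.toℚᵘ-homo-* q q) ⟩
    toℚᵘ (q * q)                                         ≈⟨ ℚ.toℚᵘ-cong eq ⟩
    toℚᵘ ((t * t - + 2 / 1) * (t * t - + 3 / 1))         ≈⟨ ℚ.toℚᵘ-homo-* (t * t - + 2 / 1) (t * t - + 3 / 1) ⟩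
    toℚᵘ (t * t - + 2 / 1) *ᵘ toℚᵘ (t * t - + 3 / 1)     ≈⟨ ℚᵘ.*-cong (toℚᵘ-homo-minus (t * t) (+ 2 / 1))
                                                                    (toℚᵘ-homo-minus (t * t) (+ 3 / 1)) ⟩
    (toℚᵘ (t * t) -ᵘ mkℚᵘ (+ 2) 0) *ᵘ (toℚᵘ (t * t) -ᵘ mkℚᵘ (+ 3) 0) ≈⟨ ℚᵘ.*-cong (ℚᵘ.+-congˡ _ (ℚ.toℚᵘ-homo-* t t))
                                                                              (ℚᵘ.+-congˡ _ (ℚ.toℚᵘ-homo-* t t)) ⟩
    (toℚᵘ t *ᵘ toℚᵘ t -ᵘ mkℚᵘ (+ 2) 0) *ᵘ (toℚᵘ t *ᵘ toℚᵘ t -ᵘ mkℚᵘ (+ 3) 0) ∎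

proposition18 : (t q : ℚ) → ¬ (q * q ≡ (t * t - + 2 / 1) * (t * t - + 3 / 1))
proposition18 t@(mkℚ A b coprime) q@(mkℚ C d _) eq
  with integer-square-cancel (quartic A ℤ.+[1+ b ]) d (C ℤ.* (ℤ.+[1+ b ] ℤ.* ℤ.+[1+ b ])) (clear-denominators t q eq)
... | w , quartic≡w² = quartic≢square A b w (recompute coprime) quartic≡w²
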